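{- Let $n\ge 2$, let $A\in M$ with $\deg(A)=k$, and let $g$ be an integer with $1\le g\le n-1$ and $\gcd(g,n)=1$. Put $B=g\cdot A$, $u=m(A)$ and $v=m(B)$. If $k\ge gu-v$, then $ug^2-(k+u+v)g+v(n+1)\ge 0$.
   Context: Let $\mathbb{N}=\{0,1,2,\ldots\}$ and $M=\{(a_1,\ldots,a_{n-1})\in\mathbb{N}^{n-1} : a_1+2a_2+\cdots+(n-1)a_{n-1}\equiv 0 \pmod n\}$. For $A=(a_1,\ldots,a_{n-1})\in M$, $\deg(A)=a_1+\cdots+a_{n-1}$ and the multiplicity is $m(A)=(a_1+2a_2+\cdots+(n-1)a_{n-1})/n$. For $1\le g\le n-1$ with $\gcd(g,n)=1$, let $\sigma_g$ be the permutation of $\{1,\ldots,n-1\}$ with $\sigma_g(i)\equiv gi\pmod n$, and $g\cdot A=(a_{\sigma_g^{ -1}(1)},\ldots,a_{\sigma_g^{ -1}(n-1)})\in M$. Equivalently, viewing $A$ as the multiset consisting of $a_i$ copies of $i$ for each $i$, $g\cdot A$ is the multiset obtained by replacing each element $y$ by the residue of $gy$ modulo $n$ in $\{1,\ldots,n-1\}$. -}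

module Defs where

open import Data.Nat using (ℕ; zero; suc; _+_; _*_; _∸_; NonZero; _≟_)
open import Data.Nat.DivMod using (_%_; _/_)
open import Data.Fin using (Fin; toℕ)
open import Relation.Nullary using (Dec; yes; no)
open import Relation.Binary.PropositionalEquality using (_≡_)

sumFin : (m : ℕ) → (Fin m → ℕ) → ℕ
sumFin zero    f = 0
sumFin (suc m) f = f Fin.zero + sumFin m (λ j → f (Fin.suc j))

-- An exponent vector A = (a_1, …, a_{n-1}) is a function Fin (n ∸ 1) → ℕ,
-- where the entry at index j : Fin (n ∸ 1) is a_{toℕ j + 1}.
Vect : ℕ → Set
Vect n = Fin (n ∸ 1) → ℕ

deg : (n : ℕ) → Vect n → ℕ
deg n A = sumFin (n ∸ 1) A

weight : (n : ℕ) → Vect n → ℕ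
weight n A = sumFin (n ∸ 1) (λ j → (toℕ j + 1) * A j)

InM : (n : ℕ) .{{_ : NonZero n}} → Vect n → Set
InM n A = weight n A % n ≡ 0

mult : (n : ℕ) .{{_ : NonZero n}} → Vect n → ℕ
mult n A = weight n A / n

-- g · A, as a multiset: each element y (= index j+1) replaced by (g y mod n);
-- so (g·A)_i = Σ_{j : g(j+1) ≡ i (mod n)} a_{j+1}.
act : (n : ℕ) .{{_ : NonZero n}} → ℕ → Vect n → Vect n
act n g A i = sumFin (n ∸ 1) (λ j → pick ((g * (toℕ j + 1)) % n ≟ (toℕ i + 1)) (A j))
  where
  pick : ∀ {P : Set} → Dec P → ℕ → ℕ
  pick (yes _) a = a
  pick (no _)  _ = 0

{-# OPTIONS --safe #-}
-- View A as a multiset of residues y ∈ {1, …, n-1} and write g y = t + q n. As g is a unit,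
-- 0 < t < n, and g·A is the multiset of the t's, so n u = Σ y and n v = Σ t over A. For each
-- element, (g² y + (n+1) t) - (n g + g y + g t) = n (g q + t - g - q) ≥ 0: for q = 0 because
-- t = g y ≥ g, otherwise because g q + 1 ≥ g + q. Summing over A and dividing by n gives
-- (k + u + v) g ≤ u g² + v (n + 1).
module Submission where

open import Defs
open import Data.Nat using (ℕ; _≤_; _<_; NonZero)
open import Data.Nat.GCD using (gcd)
open import Relation.Binary.PropositionalEquality using (_≡_)
import Data.Integer as ℤ
import Data.Nat as ℕ

open import Data.Bool using (if_then_else_)
open import Data.Fin using (Fin; zero; suc; toℕ; fromℕ<)
import Data.Fin.Properties as Fin
open import Data.List using ([]; _∷_)
open import Data.Nat using (zero; suc; _∸_; _>_; z≤n; s≤s; >-nonZero)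
open import Data.Nat.Coprimality using (Coprime; coprime-divisor; gcd≡1⇒coprime)
import Data.Nat.Coprimality as Coprime
open import Data.Nat.DivMod using (_%_; _/_; m≡m%n+[m/n]*n; m*[n/m]≡n; m%n<n)
open import Data.Nat.Divisibility using (_∣_; m%n≡0⇒n∣m; n∣m⇒m%n≡0; ∣m+n∣m⇒∣n; ∣n⇒∣m*n; m∣m*n; ∣⇒≤)
open import Data.Nat.Properties
open import Algebra.Properties.Semiring.Sum +-*-semiring
  using (sum; sum-syntax; sum-cong-≗; sum-replicate-zero; ∑-distrib-+; ∑-comm; *-distribˡ-sum)
open import Data.Product using (Σ; _,_; proj₁; proj₂)
open import Function using (_∘_)
open import Relation.Nullary using (does; yes; no)
open import Relation.Nullary.Decidable using (dec-true; dec-false)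
open import Relation.Binary.PropositionalEquality
  using (_≢_; refl; sym; trans; cong; cong₂; subst; subst₂; module ≡-Reasoning)

-- ℕ arithmetic is opened only in this block, leaving _+_ and _*_ to ℤ in the theorem statement.
module _ where
  open import Data.Nat using (_+_; _*_)
  open import Data.Nat.Tactic.RingSolver using (solve; solve-∀)

  ⟦_⟧ : ∀ {m} → Fin m → ℕ
  ⟦ j ⟧ = toℕ j + 1

  ⟦j⟧<n : ∀ {n} .{{_ : NonZero n}} (j : Fin (n ∸ 1)) → ⟦ j ⟧ < n
  ⟦j⟧<n {n} j = subst (_< n) (+-comm 1 (toℕ j)) (m≤pred[n]⇒suc[m]≤n (Fin.toℕ<n j))

  sumFin≡sum : ∀ m (f : Fin m → ℕ) → sumFin m f ≡ sum f
  sumFin≡sum zero    f = refl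
  sumFin≡sum (suc m) f = cong (f zero +_) (sumFin≡sum m (f ∘ suc))

  sum-mono-≤ : ∀ {m} {f h : Fin m → ℕ} → (∀ j → f j ≤ h j) → sum f ≤ sum h
  sum-mono-≤ {zero}  _   = z≤n
  sum-mono-≤ {suc m} f≤h = +-mono-≤ (f≤h zero) (sum-mono-≤ (f≤h ∘ suc))

  sum-linear : ∀ {m} c d (f h : Fin m → ℕ) → ∑[ j < m ] (c * f j + d * h j) ≡ c * sum f + d * sum h
  sum-linear {m} c d f h =
    trans (∑-distrib-+ {m} _ _) (cong₂ _+_ (sym (*-distribˡ-sum c f)) (sym (*-distribˡ-sum d h)))

  sum-singleSupport : ∀ {m} (f : Fin m → ℕ) (i : Fin m) → (∀ j → j ≢ i → f j ≡ 0) → sum f ≡ f i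
  sum-singleSupport {suc m} f zero f≡0 = begin
    f zero + sum (f ∘ suc)          ≡⟨ cong (f zero +_) (sum-cong-≗ (λ j → f≡0 (suc j) λ ())) ⟩
    f zero + sum {m} (λ _ → 0)      ≡⟨ cong (f zero +_) (sum-replicate-zero m) ⟩
    f zero + 0                      ≡⟨ +-identityʳ (f zero) ⟩
    f zero                          ∎
    where open ≡-Reasoning
  sum-singleSupport {suc m} f (suc i) f≡0 =
    cong₂ _+_ (f≡0 zero λ ()) (sum-singleSupport (f ∘ suc) i λ j j≢i → f≡0 (suc j) (j≢i ∘ Fin.suc-injective))

  sum-indicator : ∀ {m} t a → 1 ≤ t → t ≤ m →
    ∑[ i < m ] (⟦ i ⟧ * (if does (t ≟ ⟦ i ⟧) then a else 0)) ≡ t * a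
  sum-indicator {m} t a 1≤t t≤m = trans (sum-singleSupport _ i₀ off) on
    where
    i₀ : Fin m
    i₀ = fromℕ< (pred-mono-< {{>-nonZero 1≤t}} (s≤s t≤m))
    ⟦i₀⟧≡t : ⟦ i₀ ⟧ ≡ t
    ⟦i₀⟧≡t = trans (cong (_+ 1) (Fin.toℕ-fromℕ< _)) (m∸n+n≡m 1≤t)
    off : ∀ j → j ≢ i₀ → ⟦ j ⟧ * (if does (t ≟ ⟦ j ⟧) then a else 0) ≡ 0
    off j j≢i₀ = trans (cong (λ b → ⟦ j ⟧ * (if b then a else 0)) (dec-false (t ≟ ⟦ j ⟧) t≢⟦j⟧)) (*-zeroʳ ⟦ j ⟧)
      where
      t≢⟦j⟧ : t ≢ ⟦ j ⟧
      t≢⟦j⟧ t≡⟦j⟧ = j≢i₀ (Fin.toℕ-injective (+-cancelʳ-≡ _ _ _ (trans (sym t≡⟦j⟧) (sym ⟦i₀⟧≡t))))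
    on : ⟦ i₀ ⟧ * (if does (t ≟ ⟦ i₀ ⟧) then a else 0) ≡ t * a
    on = cong₂ (λ x b → x * (if b then a else 0)) ⟦i₀⟧≡t (dec-true (t ≟ ⟦ i₀ ⟧) (sym ⟦i₀⟧≡t))

  coprime⇒[m*o]%n>0 : ∀ {m n o} .{{_ : NonZero n}} → Coprime m n → o > 0 → o < n → (m * o) % n > 0
  coprime⇒[m*o]%n>0 {m} {n} {o} m⊥n o>0 o<n = n≢0⇒n>0 λ [m*o]%n≡0 →
    <⇒≱ o<n (∣⇒≤ {{>-nonZero o>0}} (coprime-divisor (Coprime.sym m⊥n) (m%n≡0⇒n∣m (m * o) n [m*o]%n≡0)))

  g+q≤g*q+t : ∀ {g y t q n} → 1 ≤ g → 1 ≤ y → g * y ≡ t + q * n → 1 ≤ t → g + q ≤ g * q + t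
  g+q≤g*q+t {g} {y} {t} {zero} _ 1≤y gy≡t+qn _ = begin
    g + 0     ≡⟨ +-identityʳ g ⟩
    g         ≤⟨ m≤m*n g y {{>-nonZero 1≤y}} ⟩
    g * y     ≡⟨ trans gy≡t+qn (+-identityʳ t) ⟩
    t         ≡⟨ cong (_+ t) (*-zeroʳ g) ⟨
    g * 0 + t ∎
    where open ≤-Reasoning
  g+q≤g*q+t {g} {y} {t} {suc q} 1≤g _ _ 1≤t = begin
    g + (1 + q)     ≤⟨ +-monoʳ-≤ g (+-mono-≤ 1≤t (m≤n*m q g {{>-nonZero 1≤g}})) ⟩
    g + (t + g * q) ≡⟨ solve (g ∷ q ∷ t ∷ []) ⟩
    g * suc q + t   ∎
    where open ≤-Reasoning

  summand-≤ : ∀ {g y t q n} a → 1 ≤ g → 1 ≤ y → g * y ≡ t + q * n → 1 ≤ t →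
    n * g * a + g * (y * a + t * a) ≤ g * g * (y * a) + (n + 1) * (t * a)
  summand-≤ {g} {y} {t} {q} {n} a 1≤g 1≤y gy≡t+qn 1≤t = begin
    n * g * a + g * (y * a + t * a)         ≡⟨ solve (n ∷ g ∷ y ∷ t ∷ a ∷ []) ⟩
    n * g * a + g * y * a + g * (t * a)     ≡⟨ cong (λ z → n * g * a + z * a + g * (t * a)) gy≡t+qn ⟩
    n * g * a + (t + q * n) * a + g * (t * a) ≡⟨ solve (n ∷ g ∷ t ∷ q ∷ a ∷ []) ⟩
    (n * (g + q) + (g * t + t)) * a         ≤⟨ *-monoˡ-≤ a (+-monoˡ-≤ _ (*-monoʳ-≤ n (g+q≤g*q+t 1≤g 1≤y gy≡t+qn 1≤t))) ⟩
    (n * (g * q + t) + (g * t + t)) * a     ≡⟨ solve (n ∷ g ∷ t ∷ q ∷ a ∷ []) ⟩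
    g * ((t + q * n) * a) + (n + 1) * (t * a) ≡⟨ cong (λ z → g * (z * a) + (n + 1) * (t * a)) gy≡t+qn ⟨
    g * (g * y * a) + (n + 1) * (t * a)     ≡⟨ solve (n ∷ g ∷ y ∷ t ∷ a ∷ []) ⟩
    g * g * (y * a) + (n + 1) * (t * a)     ∎
    where open ≤-Reasoning

  act-≡-∑ : ∀ n .{{_ : NonZero n}} g (A : Vect n) i →
    act n g A i ≡ ∑[ j < n ∸ 1 ] (if does ((g * ⟦ j ⟧) % n ≟ ⟦ i ⟧) then A j else 0)
  act-≡-∑ n g A i =
    trans (proj₂ summands) (trans (sumFin≡sum (n ∸ 1) (proj₁ summands)) (sum-cong-≗ summand≡))
    where
    -- The summands of act apply pick, a where-function of Defs that cannot be named here:
    -- the Σ names them, so that summand≡ can be stated and proved by with.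
    summands : Σ (Vect n) λ F → act n g A i ≡ sumFin (n ∸ 1) F
    summands = _ , refl
    summand≡ : ∀ j → proj₁ summands j ≡ (if does ((g * ⟦ j ⟧) % n ≟ ⟦ i ⟧) then A j else 0)
    summand≡ j with (g * ⟦ j ⟧) % n ≟ ⟦ i ⟧
    ... | yes p = cong (λ b → if b then A j else 0) (sym (dec-true ((g * ⟦ j ⟧) % n ≟ ⟦ i ⟧) p))
    ... | no ¬p = cong (λ b → if b then A j else 0) (sym (dec-false ((g * ⟦ j ⟧) % n ≟ ⟦ i ⟧) ¬p))

  [g*⟦j⟧]%n>0 : ∀ {n} .{{_ : NonZero n}} {g} → Coprime g n → (j : Fin (n ∸ 1)) → (g * ⟦ j ⟧) % n > 0
  [g*⟦j⟧]%n>0 g⊥n j = coprime⇒[m*o]%n>0 g⊥n (m≤n+m 1 (toℕ j)) (⟦j⟧<n j)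

  weight-act : ∀ n .{{_ : NonZero n}} g (A : Vect n) → Coprime g n →
    weight n (act n g A) ≡ ∑[ j < n ∸ 1 ] ((g * ⟦ j ⟧) % n * A j)
  weight-act n g A g⊥n = begin
    weight n (act n g A)                   ≡⟨ sumFin≡sum m _ ⟩
    ∑[ i < m ] (⟦ i ⟧ * act n g A i)        ≡⟨ sum-cong-≗ (λ i → cong (⟦ i ⟧ *_) (act-≡-∑ n g A i)) ⟩
    ∑[ i < m ] (⟦ i ⟧ * ∑[ j < m ] δ i j)   ≡⟨ sum-cong-≗ (λ i → *-distribˡ-sum ⟦ i ⟧ (δ i)) ⟩
    ∑[ i < m ] ∑[ j < m ] (⟦ i ⟧ * δ i j)   ≡⟨ ∑-comm (λ i j → ⟦ i ⟧ * δ i j) ⟩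
    ∑[ j < m ] ∑[ i < m ] (⟦ i ⟧ * δ i j)   ≡⟨ sum-cong-≗ collapse ⟩
    ∑[ j < m ] (r j * A j)                  ∎
    where
    open ≡-Reasoning
    m : ℕ
    m = n ∸ 1
    r : Fin m → ℕ
    r j = (g * ⟦ j ⟧) % n
    δ : Fin m → Fin m → ℕ
    δ i j = if does (r j ≟ ⟦ i ⟧) then A j else 0
    collapse : ∀ j → ∑[ i < m ] (⟦ i ⟧ * δ i j) ≡ r j * A j
    collapse j = sum-indicator (r j) (A j) ([g*⟦j⟧]%n>0 g⊥n j) (<⇒≤pred (m%n<n (g * ⟦ j ⟧) n))

  g*weight-divMod : ∀ n .{{_ : NonZero n}} g (A : Vect n) →
    g * weight n A ≡ n * ∑[ j < n ∸ 1 ] ((g * ⟦ j ⟧) / n * A j) + ∑[ j < n ∸ 1 ] ((g * ⟦ j ⟧) % n * A j)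
  g*weight-divMod n g A = begin
    g * weight n A                              ≡⟨ cong (g *_) (sumFin≡sum (n ∸ 1) _) ⟩
    g * ∑[ j < n ∸ 1 ] (⟦ j ⟧ * A j)             ≡⟨ *-distribˡ-sum {n ∸ 1} g _ ⟩
    ∑[ j < n ∸ 1 ] (g * (⟦ j ⟧ * A j))           ≡⟨ sum-cong-≗ split ⟩
    ∑[ j < n ∸ 1 ] (n * (q j * A j) + r j * A j) ≡⟨ ∑-distrib-+ (λ j → n * (q j * A j)) (λ j → r j * A j) ⟩
    ∑[ j < n ∸ 1 ] (n * (q j * A j)) + ∑[ j < n ∸ 1 ] (r j * A j) ≡⟨ cong (_+ ∑[ j < n ∸ 1 ] (r j * A j)) (*-distribˡ-sum {n ∸ 1} n _) ⟨
    n * ∑[ j < n ∸ 1 ] (q j * A j) + ∑[ j < n ∸ 1 ] (r j * A j) ∎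
    where
    open ≡-Reasoning
    r q : Fin (n ∸ 1) → ℕ
    r j = (g * ⟦ j ⟧) % n
    q j = (g * ⟦ j ⟧) / n
    rearrange : ∀ x y a → (x + y * n) * a ≡ n * (y * a) + x * a
    rearrange x y a = solve (x ∷ y ∷ n ∷ a ∷ [])
    split : ∀ j → g * (⟦ j ⟧ * A j) ≡ n * (q j * A j) + r j * A j
    split j = begin
      g * (⟦ j ⟧ * A j)        ≡⟨ *-assoc g ⟦ j ⟧ (A j) ⟨
      g * ⟦ j ⟧ * A j          ≡⟨ cong (_* A j) (m≡m%n+[m/n]*n (g * ⟦ j ⟧) n) ⟩
      (r j + q j * n) * A j    ≡⟨ rearrange (r j) (q j) (A j) ⟩
      n * (q j * A j) + r j * A j ∎

  act-InM : ∀ n .{{_ : NonZero n}} g (A : Vect n) → Coprime g n → InM n A → InM n (act n g A)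
  act-InM n g A g⊥n A∈M = n∣m⇒m%n≡0 _ n (subst (n ∣_) (sym (weight-act n g A g⊥n)) n∣T)
    where
    n∣T : n ∣ ∑[ j < n ∸ 1 ] ((g * ⟦ j ⟧) % n * A j)
    n∣T = ∣m+n∣m⇒∣n (subst (n ∣_) (g*weight-divMod n g A) (∣n⇒∣m*n g (m%n≡0⇒n∣m _ n A∈M))) (m∣m*n _)

  n*mult≡weight : ∀ n .{{_ : NonZero n}} (A : Vect n) → InM n A → n * mult n A ≡ weight n A
  n*mult≡weight n A A∈M = m*[n/m]≡n (m%n≡0⇒n∣m _ n A∈M)

  mult-inequality : ∀ n .{{_ : NonZero n}} g (A : Vect n) → 1 ≤ g → Coprime g n → InM n A →
    let u = mult n A
        v = mult n (act n g A)
    in (deg n A + u + v) * g ≤ u * g * g + v * (n + 1)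
  mult-inequality n g A 1≤g g⊥n A∈M = *-cancelˡ-≤ n (begin
    n * ((deg n A + u + v) * g)                              ≡⟨ distribute n (deg n A) u v g ⟩
    n * g * deg n A + g * (n * u + n * v)                    ≡⟨ cong₂ (λ x y → n * g * deg n A + g * (x + y)) n*u≡W n*v≡T ⟩
    n * g * deg n A + g * (W + T)                            ≡⟨ expand ⟨
    ∑[ j < m ] (n * g * A j + g * (⟦ j ⟧ * A j + r j * A j))   ≤⟨ sum-mono-≤ {m} per-element ⟩
    ∑[ j < m ] (g * g * (⟦ j ⟧ * A j) + (n + 1) * (r j * A j)) ≡⟨ sum-linear {m} (g * g) (n + 1) _ _ ⟩
    g * g * W + (n + 1) * T                                  ≡⟨ cong₂ (λ x y → g * g * x + (n + 1) * y) n*u≡W n*v≡T ⟨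
    g * g * (n * u) + (n + 1) * (n * v)                      ≡⟨ collect n u v g ⟩
    n * (u * g * g + v * (n + 1))                            ∎)
    where
    open ≤-Reasoning
    m u v : ℕ
    m = n ∸ 1
    u = mult n A
    v = mult n (act n g A)
    r : Fin m → ℕ
    r j = (g * ⟦ j ⟧) % n
    W T : ℕ
    W = ∑[ j < m ] (⟦ j ⟧ * A j)
    T = ∑[ j < m ] (r j * A j)
    n*u≡W : n * u ≡ W
    n*u≡W = trans (n*mult≡weight n A A∈M) (sumFin≡sum m _)
    n*v≡T : n * v ≡ T
    n*v≡T = trans (n*mult≡weight n (act n g A) (act-InM n g A g⊥n A∈M)) (weight-act n g A g⊥n)
    per-element : ∀ j → n * g * A j + g * (⟦ j ⟧ * A j + r j * A j) ≤ g * g * (⟦ j ⟧ * A j) + (n + 1) * (r j * A j)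
    per-element j =
      summand-≤ {q = (g * ⟦ j ⟧) / n} {n = n} (A j) 1≤g (m≤n+m 1 (toℕ j)) (m≡m%n+[m/n]*n (g * ⟦ j ⟧) n) ([g*⟦j⟧]%n>0 g⊥n j)
    distribute : ∀ a k b c d → a * ((k + b + c) * d) ≡ a * d * k + d * (a * b + a * c)
    distribute = solve-∀
    collect : ∀ a b c d → d * d * (a * b) + (a + 1) * (a * c) ≡ a * (b * d * d + c * (a + 1))
    collect = solve-∀
    expand : ∑[ j < m ] (n * g * A j + g * (⟦ j ⟧ * A j + r j * A j)) ≡ n * g * deg n A + g * (W + T)
    expand = trans (sum-linear {m} (n * g) g A _)
      (cong₂ (λ x y → n * g * x + g * y) (sym (sumFin≡sum m A)) (∑-distrib-+ {m} (λ j → ⟦ j ⟧ * A j) r*A))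
      where
      r*A : Fin m → ℕ
      r*A j = r j * A j

open import Data.Integer using (+_; _+_; _-_; _*_)
import Data.Integer.Properties as ℤ
open import Data.Integer.Tactic.RingSolver as ℤ using ()

y≤x+z⇒0≤x-y+z : ∀ {x y z} → y ℤ.≤ x + z → + 0 ℤ.≤ x - y + z
y≤x+z⇒0≤x-y+z {x} {y} {z} y≤x+z = subst (+ 0 ℤ.≤_) (reorder x y z) (ℤ.i≤j⇒0≤j-i y≤x+z)
  where
  reorder : ∀ x y z → x + z - y ≡ x - y + z
  reorder = ℤ.solve-∀

toℤ-inequality : ∀ k u v g n → (k ℕ.+ u ℕ.+ v) ℕ.* g ≤ u ℕ.* g ℕ.* g ℕ.+ v ℕ.* (n ℕ.+ 1) →
  + 0 ℤ.≤ (+ u) * (+ g) * (+ g) - (+ k + + u + + v) * (+ g) + (+ v) * (+ n + + 1)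
toℤ-inequality k u v g n ≤ℕ =
  y≤x+z⇒0≤x-y+z {+ u * + g * + g} {(+ k + + u + + v) * + g} {+ v * (+ n + + 1)} (subst₂ ℤ._≤_
    (ℤ.pos-* (k ℕ.+ u ℕ.+ v) g)
    (cong₂ _+_ (trans (ℤ.pos-* (u ℕ.* g) g) (cong (_* + g) (ℤ.pos-* u g))) (ℤ.pos-* v (n ℕ.+ 1)))
    (ℤ.+≤+ ≤ℕ))

mainTheorem2 : (n : ℕ) .{{_ : NonZero n}} → 2 ≤ n →
    (A : Vect n) → InM n A →
    (k : ℕ) → deg n A ≡ k →
    (g : ℕ) → 1 ≤ g → g < n → gcd g n ≡ 1 →
    let u = mult n A
        v = mult n (act n g A)
    in (+ k) ℤ.≥ (+ g) * (+ u) - (+ v) →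
       (+ u) * (+ g) * (+ g) - (+ k + + u + + v) * (+ g) + (+ v) * (+ n + + 1) ℤ.≥ + 0
-- The bound holds for every A ∈ M and unit g.
mainTheorem2 n _ A A∈M k refl g 1≤g _ gcd≡1 _ =
  toℤ-inequality k (mult n A) (mult n (act n g A)) g n (mult-inequality n g A 1≤g (gcd≡1⇒coprime gcd≡1) A∈M)
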